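{- Let $\ell,k,\ell_{\max}$ be positive integers and $c=\lceil \max\{\ell,k\}/\min\{\ell,k\}\rceil$. There is an $(\ell,k)$-routing instance on the full-duplex infinite triangular grid in which every packet's origin and destination are at distance at most $\ell_{\max}$, such that every schedule routing each packet along a shortest path needs at least $$\left\lceil \frac{\max\{\ell,k\}}{4}\cdot\left\lfloor \frac{\ell_{\max}+1}{\sqrt{c+1}}\right\rfloor\right\rceil$$ steps.
   Context: Triangular grid: the infinite graph with vertex set $\mathbb{Z}^2$ in which $(x,y)$ is adjacent to $(x\pm1,y)$, $(x,y\pm1)$, $(x+1,y+1)$ and $(x-1,y-1)$. $(\ell,k)$-routing: a set of packets, each with an origin and a destination node, such that each node is the origin of at most $\ell$ packets and the destination of at most $k$ packets. Routing model (store-and-forward, $\Delta$-port): synchronous steps; in each step each packet either stays at its current node (unbounded queues) or moves along one incident edge; all incident edges of a node may be used simultaneously; full-duplex: each edge can be traversed by at most one packet per step in each direction. Running time: number of steps until all packets reach their destinations. -}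

module Defs where

open import Data.Nat as ℕ using (ℕ; zero; suc; _≤_; _<_; _⊔_; _⊓_; _∸_)
open import Data.Nat.DivMod using (_/_)
open import Data.Integer as ℤ using (ℤ; 0ℤ; 1ℤ; -1ℤ)
open import Data.Product using (Σ; ∃; _×_; _,_; proj₁; proj₂)
open import Data.Product.Properties using (≡-dec)
open import Data.Sum using (_⊎_)
open import Data.Fin using (Fin)
open import Data.List using (List; length; filter)
open import Data.List.Base using (allFin)
open import Data.Empty using (⊥)
open import Relation.Binary.PropositionalEquality using (_≡_; _≢_)
open import Relation.Binary using (DecidableEquality)

-- Nodes of the triangular grid: ℤ²
Node : Set
Node = ℤ × ℤ

_≟ₙ_ : DecidableEquality Node
_≟ₙ_ = ≡-dec ℤ._≟_ ℤ._≟_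

data Dir : Set where
  east west north south ne sw : Dir

offset : Dir → Node
offset east  = (1ℤ , 0ℤ)
offset west  = (-1ℤ , 0ℤ)
offset north = (0ℤ , 1ℤ)
offset south = (0ℤ , -1ℤ)
offset ne    = (1ℤ , 1ℤ)
offset sw    = (-1ℤ , -1ℤ)

_⊕_ : Node → Node → Node
(a , b) ⊕ (c , d) = (a ℤ.+ c , b ℤ.+ d)

Adj : Node → Node → Set
Adj u v = Σ Dir λ d → v ≡ u ⊕ offset d

data Walk : Node → Node → ℕ → Set where
  []  : ∀ {u} → Walk u u 0
  _∷_ : ∀ {u v w n} → Adj u v → Walk v w n → Walk u w (suc n)

-- vertex at position p of a walk (positions beyond the end give the endpoint)
vertexAt : ∀ {u v n} → Walk u v n → ℕ → Node
vertexAt {u} []      _       = u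
vertexAt {u} (_ ∷ w) zero    = u
vertexAt     (_ ∷ w) (suc p) = vertexAt w p

IsShortest : ∀ {u v n} → Walk u v n → Set
IsShortest {u} {v} {n} _ = ∀ m → Walk u v m → n ≤ m

DistLe : Node → Node → ℕ → Set
DistLe u v d = Σ ℕ λ n → n ≤ d × Walk u v n

record Instance : Set where
  field
    P      : ℕ
    origin : Fin P → Node
    dest   : Fin P → Node

#orig : Instance → Node → ℕ
#orig I v = length (filter (λ i → Instance.origin I i ≟ₙ v) (allFin (Instance.P I)))

#dest : Instance → Node → ℕ
#dest I v = length (filter (λ i → Instance.dest I i ≟ₙ v) (allFin (Instance.P I)))

IsRouting : ℕ → ℕ → Instance → Set
IsRouting ℓ k I = ∀ v → #orig I v ≤ ℓ × #dest I v ≤ k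

MaxDist : ℕ → Instance → Set
MaxDist lmax I = ∀ i → DistLe (Instance.origin I i) (Instance.dest I i) lmax

-- A store-and-forward schedule on the full-duplex triangular grid, in which
-- every packet follows a shortest path, and all packets are at their
-- destination at time T.  prog i t is the position (number of edges
-- travelled) of packet i along its route at time t.
record ShortestPathSchedule (I : Instance) (T : ℕ) : Set where
  open Instance I
  field
    len      : Fin P → ℕ
    route    : (i : Fin P) → Walk (origin i) (dest i) (len i)
    shortest : (i : Fin P) → IsShortest (route i)
    prog     : Fin P → ℕ → ℕ
    start    : ∀ i → prog i 0 ≡ 0
    step     : ∀ i t → prog i (suc t) ≡ prog i t ⊎ prog i (suc t) ≡ suc (prog i t)
    bounded  : ∀ i t → prog i t ≤ len i
    finish   : ∀ i → prog i T ≡ len i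
  pos : Fin P → ℕ → Node
  pos i t = vertexAt (route i) (prog i t)
  Moves : Fin P → ℕ → Set
  Moves i t = prog i (suc t) ≡ suc (prog i t)
  field
    -- full duplex: at most one packet per step per edge per direction
    capacity : ∀ i j t → i ≢ j → Moves i t → Moves j t →
               pos i t ≡ pos j t → pos i (suc t) ≡ pos j (suc t) → ⊥

-- ⌈ a / b ⌉ (with value 0 for b = 0, never used)
ceilDiv : ℕ → ℕ → ℕ
ceilDiv a zero    = 0
ceilDiv a (suc b) = (a ℕ.+ b) / suc b

module Submission where

-- With L = max(ℓ,k),
-- s = min(ℓ,k), c = ⌈L/s⌉, S = ⌊√c⌋ and a = ⌊lmax/S⌋, cut the plane into a×a blocks.
-- Each node of a hub block sends (if k ≤ ℓ) or receives (if ℓ < k) L packets, in groups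
-- of s; each group is paired with the same node of its own spoke block, one of the
-- (S+1)² - 1 blocks at block distance ≤ S.  So at most L resp. s packets end at a node,
-- and every packet travels at most S·a ≤ lmax.
--
-- A shortest path to a target north-east of its start makes only east, north and
-- north-east steps (a potential argument), so it crosses the boundary of the hub block
-- along one of 4a directed edges; by edge capacity a²L ≤ 4a·T.  As m²(c+1) ≤ (lmax+1)²
-- forces m ≤ a, this gives ⌈L·m/4⌉ ≤ T.

open import Defs
open import Data.Nat as ℕ using (ℕ; zero; suc; z≤n; s≤s; NonZero; _+_; _*_; _∸_; _≤_; _<_; _⊔_; _⊓_)
import Data.Nat.Properties as ℕP
open import Data.Nat.DivMod
open import Data.Nat.Divisibility using (divides)
open import Data.Nat.Tactic.RingSolver using (solve-∀)
open import Data.Integer as ℤ using (ℤ; +_; 0ℤ; 1ℤ)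
import Data.Integer.Properties as ℤP
import Data.Integer.Tactic.RingSolver as ℤSolver
open import Algebra.Bundles using (AbelianGroup)
open import Algebra.Properties.Group (AbelianGroup.group ℤP.+-0-abelianGroup) using (∙-cancelˡ)
open import Data.Fin as Fin using (Fin; toℕ; fromℕ; fromℕ<; inject₁; remQuot; combine)
import Data.Fin.Properties as FinP
open import Data.List using (List; []; _∷_; map; _++_; length; lookup; filter; allFin)
import Data.List.Properties as ListP
open import Data.List.Membership.Propositional using (_∈_)
open import Data.List.Membership.Propositional.Properties using (∈-map⁺; ∈-++⁺ˡ; ∈-++⁺ʳ; ∈-allFin; ∈-lookup)
open import Data.List.Relation.Unary.All as All using (All)
open import Data.List.Relation.Unary.All.Properties using (all-filter)
open import Data.List.Relation.Unary.AllPairs using (_∷_)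
open import Data.List.Relation.Unary.Any using (index)
open import Data.List.Relation.Unary.Any.Properties using (lookup-index)
open import Data.List.Relation.Unary.Unique.Propositional using (Unique)
import Data.List.Relation.Unary.Unique.Propositional.Properties as Unique
open import Data.Product using (Σ; ∃; _×_; _,_; proj₁; proj₂; uncurry)
open import Data.Sum using (_⊎_; inj₁; inj₂)
open import Data.Empty using (⊥-elim)
open import Function using (id)
open import Relation.Nullary using (¬_; yes; no; ¬?)
open import Relation.Nullary.Decidable using (decidable-stable)
open import Relation.Unary using (Decidable)
open import Relation.Binary.PropositionalEquality

⊕-assoc : ∀ u v w → (u ⊕ v) ⊕ w ≡ u ⊕ (v ⊕ w)
⊕-assoc (u₁ , u₂) (v₁ , v₂) (w₁ , w₂) = cong₂ _,_ (ℤP.+-assoc u₁ v₁ w₁) (ℤP.+-assoc u₂ v₂ w₂)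

⊕-identityʳ : ∀ u → u ⊕ (0ℤ , 0ℤ) ≡ u
⊕-identityʳ (u₁ , u₂) = cong₂ _,_ (ℤP.+-identityʳ u₁) (ℤP.+-identityʳ u₂)

reverse : Dir → Dir
reverse east  = west
reverse west  = east
reverse north = south
reverse south = north
reverse ne    = sw
reverse sw    = ne

offset-reverse : ∀ d → offset d ⊕ offset (reverse d) ≡ (0ℤ , 0ℤ)
offset-reverse east  = refl
offset-reverse west  = refl
offset-reverse north = refl
offset-reverse south = refl
offset-reverse ne    = refl
offset-reverse sw    = refl

⊕-undo : ∀ u d → (u ⊕ offset d) ⊕ offset (reverse d) ≡ u
⊕-undo u d = trans (⊕-assoc u (offset d) (offset (reverse d)))
                   (trans (cong (u ⊕_) (offset-reverse d)) (⊕-identityʳ u))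

⊕-cancel-offset : ∀ {u v} d → u ⊕ offset d ≡ v ⊕ offset d → u ≡ v
⊕-cancel-offset {u} {v} d e =
  trans (sym (⊕-undo u d)) (trans (cong (_⊕ offset (reverse d)) e) (⊕-undo v d))

vertexAt-start : ∀ {u v n} (w : Walk u v n) → vertexAt w 0 ≡ u
vertexAt-start []      = refl
vertexAt-start (_ ∷ _) = refl

vertexAt-end : ∀ {u v n} (w : Walk u v n) → vertexAt w n ≡ v
vertexAt-end []                = refl
vertexAt-end (_ ∷ [])          = refl
vertexAt-end (_ ∷ w@(_ ∷ _))   = vertexAt-end w

move : ∀ {u w n} d → Walk (u ⊕ offset d) w n → Walk u w (suc n)
move d w = (d , refl) ∷ w

-- A walk to u + (dx,dy) of length max(dx,dy), using north-east steps as long as possible;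
-- it bounds the length of shortest paths into the north-east quadrant.
diagonalWalk : ∀ u dx dy → Walk u (u ⊕ (+ dx , + dy)) (dx ⊔ dy)
diagonalWalk u zero zero = subst (λ v → Walk u v 0) (sym (⊕-identityʳ u)) []
diagonalWalk u (suc dx) zero =
  move east (subst₂ (Walk (u ⊕ offset east)) (⊕-assoc u (offset east) (+ dx , + 0)) (ℕP.⊔-identityʳ dx)
                    (diagonalWalk (u ⊕ offset east) dx zero))
diagonalWalk u zero (suc dy) =
  move north (subst (λ v → Walk (u ⊕ offset north) v dy) (⊕-assoc u (offset north) (+ 0 , + dy))
                    (diagonalWalk (u ⊕ offset north) zero dy))
diagonalWalk u (suc dx) (suc dy) =
  move ne (subst (λ v → Walk (u ⊕ offset ne) v (dx ⊔ dy)) (⊕-assoc u (offset ne) (+ dx , + dy))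
                 (diagonalWalk (u ⊕ offset ne) dx dy))

-- The defect of step d is
-- δ d = 1 - φ(offset d); along a walk of length n, φ rises by n minus the total defect,
-- so a walk whose rise is n has only defect-free steps.
module Potential (φ : Node → ℤ) (φ-⊕ : ∀ u v → φ (u ⊕ v) ≡ φ u ℤ.+ φ v)
                 (δ : Dir → ℕ) (δ-spec : ∀ d → φ (offset d) ℤ.+ + δ d ≡ 1ℤ) where

  defect : ∀ {u v n} → Walk u v n → ℕ
  defect []            = 0
  defect ((d , _) ∷ w) = δ d + defect w

  defect-eq : ∀ {u v n} (w : Walk u v n) → φ v ℤ.+ + defect w ≡ φ u ℤ.+ + n
  defect-eq []                        = refl
  defect-eq {u} {v} {suc n} ((d , refl) ∷ w) = begin
    φ v ℤ.+ (+ δ d ℤ.+ + defect w)                  ≡⟨ swap (φ v) (+ δ d) (+ defect w) ⟩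
    (φ v ℤ.+ + defect w) ℤ.+ + δ d                  ≡⟨ cong (ℤ._+ + δ d) (defect-eq w) ⟩
    (φ (u ⊕ offset d) ℤ.+ + n) ℤ.+ + δ d            ≡⟨ cong (λ z → (z ℤ.+ + n) ℤ.+ + δ d) (φ-⊕ u (offset d)) ⟩
    ((φ u ℤ.+ φ (offset d)) ℤ.+ + n) ℤ.+ + δ d      ≡⟨ regroup (φ u) (φ (offset d)) (+ n) (+ δ d) ⟩
    φ u ℤ.+ ((φ (offset d) ℤ.+ + δ d) ℤ.+ + n)      ≡⟨ cong (λ z → φ u ℤ.+ (z ℤ.+ + n)) (δ-spec d) ⟩
    φ u ℤ.+ + suc n                                 ∎
    where
    open ≡-Reasoning
    swap : ∀ x a b → x ℤ.+ (a ℤ.+ b) ≡ (x ℤ.+ b) ℤ.+ a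
    swap = ℤSolver.solve-∀
    regroup : ∀ x o m e → ((x ℤ.+ o) ℤ.+ m) ℤ.+ e ≡ x ℤ.+ ((o ℤ.+ e) ℤ.+ m)
    regroup = ℤSolver.solve-∀

  gain : ∀ {u v n} (w : Walk u v n) k → φ v ≡ φ u ℤ.+ + k → k + defect w ≡ n
  gain {u} {v} {n} w k e = ℤP.+-injective (∙-cancelˡ (φ u) _ _ (begin
    φ u ℤ.+ (+ k ℤ.+ + defect w)   ≡⟨ ℤP.+-assoc (φ u) (+ k) (+ defect w) ⟨
    (φ u ℤ.+ + k) ℤ.+ + defect w   ≡⟨ cong (ℤ._+ + defect w) e ⟨
    φ v ℤ.+ + defect w             ≡⟨ defect-eq w ⟩
    φ u ℤ.+ + n                    ∎))
    where open ≡-Reasoning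

  defect-free : ∀ {u v n} (w : Walk u v n) → defect w ≡ 0 → ∀ p → p < n →
                Σ Dir λ d → δ d ≡ 0 × vertexAt w (suc p) ≡ vertexAt w p ⊕ offset d
  defect-free ((d , refl) ∷ w) e zero    _         = d , ℕP.m+n≡0⇒m≡0 (δ d) e , vertexAt-start w
  defect-free ((d , refl) ∷ w) e (suc p) (s≤s p<n) = defect-free w (ℕP.m+n≡0⇒n≡0 (δ d) e) p p<n

data Ascent : Dir → Set where
  east  : Ascent east
  north : Ascent north
  ne    : Ascent ne

AscendingWalk : ∀ {u v n} → Walk u v n → Set
AscendingWalk {n = n} w =
  ∀ p → p < n → Σ Dir λ d → Ascent d × vertexAt w (suc p) ≡ vertexAt w p ⊕ offset d

δx δy : Dir → ℕ
δx east = 0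
δx ne = 0
δx north = 1
δx south = 1
δx west = 2
δx sw = 2
δy north = 0
δy ne = 0
δy east = 1
δy west = 1
δy south = 2
δy sw = 2

δx-spec : ∀ d → proj₁ (offset d) ℤ.+ + δx d ≡ 1ℤ
δx-spec east = refl
δx-spec west = refl
δx-spec north = refl
δx-spec south = refl
δx-spec ne = refl
δx-spec sw = refl

δy-spec : ∀ d → proj₂ (offset d) ℤ.+ + δy d ≡ 1ℤ
δy-spec east = refl
δy-spec west = refl
δy-spec north = refl
δy-spec south = refl
δy-spec ne = refl
δy-spec sw = refl

module Horizontal = Potential proj₁ (λ _ _ → refl) δx δx-spec
module Vertical = Potential proj₂ (λ _ _ → refl) δy δy-spec

ascentˣ : ∀ d → δx d ≡ 0 → Ascent d
ascentˣ east _ = east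
ascentˣ ne   _ = ne

ascentʸ : ∀ d → δy d ≡ 0 → Ascent d
ascentʸ north _ = north
ascentʸ ne    _ = ne

ascending : ∀ {u v n} (w : Walk u v n) (δ : Dir → ℕ) → (∀ d → δ d ≡ 0 → Ascent d) →
  (∀ p → p < n → Σ Dir λ d → δ d ≡ 0 × vertexAt w (suc p) ≡ vertexAt w p ⊕ offset d) →
  AscendingWalk w
ascending w δ asc free p p<n with free p p<n
... | d , δd≡0 , e = d , asc d δd≡0 , e

no-slack : ∀ k D n → k + D ≡ n → n ≤ k → D ≡ 0
no-slack k D n e n≤k = ℕP.n≤0⇒n≡0 (ℕP.+-cancelˡ-≤ k D 0
  (subst₂ _≤_ (sym e) (sym (ℕP.+-identityʳ k)) n≤k))

-- A shortest walk to u + (dx,dy) with dx, dy ≥ 0 is ascending: it is no longer than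
-- max(dx,dy), so the potential of the longer side rises at every step.
shortest-ascending : ∀ {u v n} (w : Walk u v n) → IsShortest w →
  ∀ dx dy → v ≡ u ⊕ (+ dx , + dy) → AscendingWalk w
shortest-ascending {u} {n = n} w shortest dx dy refl = by-longer-side (ℕP.≤-total dy dx)
  where
  n≤ : ∀ k → dx ⊔ dy ≡ k → n ≤ k
  n≤ k e = subst (n ≤_) e (shortest (dx ⊔ dy) (diagonalWalk u dx dy))
  by-longer-side : dy ≤ dx ⊎ dx ≤ dy → AscendingWalk w
  by-longer-side (inj₁ dy≤dx) = ascending w δx ascentˣ (Horizontal.defect-free w
    (no-slack dx (Horizontal.defect w) n (Horizontal.gain w dx refl) (n≤ dx (ℕP.m≥n⇒m⊔n≡m dy≤dx))))
  by-longer-side (inj₂ dx≤dy) = ascending w δy ascentʸ (Vertical.defect-free w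
    (no-slack dy (Vertical.defect w) n (Vertical.gain w dy refl) (n≤ dy (ℕP.m≤n⇒m⊔n≡n dx≤dy))))

first-entry : (Q : ℕ → Set) → Decidable Q → ∀ n → ¬ Q 0 → Q n →
              Σ ℕ λ p → p < n × ¬ Q p × Q (suc p)
first-entry Q Q? zero    ¬q₀ qₙ = ⊥-elim (¬q₀ qₙ)
first-entry Q Q? (suc n) ¬q₀ qₙ₊₁ with Q? n
... | no ¬qₙ = n , ℕP.n<1+n n , ¬qₙ , qₙ₊₁
... | yes qₙ with first-entry Q Q? n ¬q₀ qₙ
...   | p , p<n , ¬qₚ , qₚ₊₁ = p , ℕP.m<n⇒m<1+n p<n , ¬qₚ , qₚ₊₁

walk-entry : (B : Node → Set) → Decidable B → ∀ {u v n} (w : Walk u v n) → ¬ B u → B v →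
  Σ ℕ λ p → p < n × ¬ B (vertexAt w p) × B (vertexAt w (suc p))
walk-entry B B? {n = n} w ¬bᵤ bᵥ =
  first-entry (λ p → B (vertexAt w p)) (λ p → B? (vertexAt w p)) n
    (λ b → ¬bᵤ (subst B (vertexAt-start w) b)) (subst B (sym (vertexAt-end w)) bᵥ)

last-or-below : ∀ {n} (x : Fin (suc n)) → x ≡ fromℕ n ⊎ Σ (Fin (suc n)) λ x⁺ → toℕ x⁺ ≡ toℕ x + 1
last-or-below {zero}  Fin.zero    = inj₁ refl
last-or-below {suc n} Fin.zero    = inj₂ (Fin.suc Fin.zero , refl)
last-or-below {suc n} (Fin.suc x) with last-or-below x
... | inj₁ refl       = inj₁ refl
... | inj₂ (x⁺ , e)   = inj₂ (Fin.suc x⁺ , cong suc e)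

first-or-above : ∀ {n} (x : Fin (suc n)) → x ≡ Fin.zero ⊎ Σ (Fin (suc n)) λ x⁻ → toℕ x ≡ toℕ x⁻ + 1
first-or-above Fin.zero    = inj₁ refl
first-or-above (Fin.suc x) = inj₂ (inject₁ x , trans (cong suc (sym (FinP.toℕ-inject₁ x))) (ℕP.+-comm 1 _))

-- The ascending boundary edges of a box: east steps through a column, north steps
-- through a row, and north-east steps through both; there are 4a of them.
sides : (Dir → Node → Node × Node) → List Node → List Node → List (Node × Node)
sides edge col row = map (edge east) col ++ map (edge north) row ++ map (edge ne) (col ++ row)

length-sides : ∀ edge col row → length row ≡ length col →
               length (sides edge col row) ≡ 4 * length col
length-sides edge col row same = begin
  length (sides edge col row)
    ≡⟨ ListP.length-++ (map (edge east) col) ⟩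
  length (map (edge east) col) + length (map (edge north) row ++ map (edge ne) (col ++ row))
    ≡⟨ cong (length (map (edge east) col) ℕ.+_) (ListP.length-++ (map (edge north) row)) ⟩
  length (map (edge east) col) + (length (map (edge north) row) + length (map (edge ne) (col ++ row)))
    ≡⟨ cong₂ (λ p q → p + (q + length (map (edge ne) (col ++ row))))
             (ListP.length-map (edge east) col) (trans (ListP.length-map (edge north) row) same) ⟩
  length col + (length col + length (map (edge ne) (col ++ row)))
    ≡⟨ cong (λ p → length col + (length col + p))
            (trans (ListP.length-map (edge ne) (col ++ row))
                   (trans (ListP.length-++ col) (cong (length col ℕ.+_) same))) ⟩
  length col + (length col + (length col + length col))
    ≡⟨ four-times (length col) ⟩
  4 * length col ∎
  where
  open ≡-Reasoning
  four-times : ∀ c → c + (c + (c + c)) ≡ 4 * c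
  four-times = solve-∀

Traverses : ∀ {u v n} → Walk u v n → List (Node × Node) → Set
Traverses {n = n} w es = Σ ℕ λ p → p < n × (vertexAt w p , vertexAt w (suc p)) ∈ es

outgoing incoming : Dir → Node → Node × Node
outgoing d v = (v , v ⊕ offset d)
incoming d v = (v ⊕ offset (reverse d) , v)

-- The box [lo, lo + a)² with a = a' + 1, its cells, and its exit and entry edges.
module Box (lo a' : ℕ) where

  cell : Fin (suc a') → Fin (suc a') → Node
  cell x y = (+ (lo + toℕ x) , + (lo + toℕ y))

  InBox : Node → Set
  InBox v = ∃ λ x → ∃ λ y → v ≡ cell x y

  inBox? : Decidable InBox
  inBox? v = FinP.any? λ x → FinP.any? λ y → v ≟ₙ cell x y

  cell-⊕ : ∀ {x y x' y'} dx dy → toℕ x' ≡ toℕ x + dx → toℕ y' ≡ toℕ y + dy →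
           cell x y ⊕ (+ dx , + dy) ≡ cell x' y'
  cell-⊕ {x} {y} dx dy ex ey = cong₂ (λ p q → (+ p , + q))
    (trans (ℕP.+-assoc lo (toℕ x) dx) (cong (lo ℕ.+_) (sym ex)))
    (trans (ℕP.+-assoc lo (toℕ y) dy) (cong (lo ℕ.+_) (sym ey)))

  column row : Fin (suc a') → List Node
  column x = map (cell x) (allFin (suc a'))
  row y = map (λ x → cell x y) (allFin (suc a'))

  lastColumn lastRow firstColumn firstRow : List Node
  lastColumn  = column (fromℕ a')
  lastRow     = row (fromℕ a')
  firstColumn = column Fin.zero
  firstRow    = row Fin.zero

  exitEdges entryEdges : List (Node × Node)
  exitEdges  = sides outgoing lastColumn lastRow
  entryEdges = sides incoming firstColumn firstRow

  length-allFin : length (allFin (suc a')) ≡ suc a'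
  length-allFin = ListP.length-tabulate (λ x → x)

  boundary-length : ∀ edge x y → length (sides edge (column x) (row y)) ≡ 4 * suc a'
  boundary-length edge x y =
    trans (length-sides edge (column x) (row y)
            (trans (ListP.length-map _ (allFin (suc a'))) (sym (ListP.length-map (cell x) (allFin (suc a'))))))
          (cong (4 *_) (trans (ListP.length-map (cell x) (allFin (suc a'))) length-allFin))

  via-east : ∀ edge col row {v} → v ∈ col → edge east v ∈ sides edge col row
  via-east edge col row m = ∈-++⁺ˡ (∈-map⁺ (edge east) m)

  via-north : ∀ edge col row {v} → v ∈ row → edge north v ∈ sides edge col row
  via-north edge col row m = ∈-++⁺ʳ (map (edge east) col) (∈-++⁺ˡ (∈-map⁺ (edge north) m))

  via-ne : ∀ edge col row {v} → v ∈ col ++ row → edge ne v ∈ sides edge col row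
  via-ne edge col row m =
    ∈-++⁺ʳ (map (edge east) col) (∈-++⁺ʳ (map (edge north) row) (∈-map⁺ (edge ne) m))

  on-column : ∀ x y → cell x y ∈ column x
  on-column x y = ∈-map⁺ (cell x) (∈-allFin y)

  on-row : ∀ x y → cell x y ∈ row y
  on-row x y = ∈-map⁺ (λ x → cell x y) (∈-allFin x)

  exit-edge : ∀ {x y d} → Ascent d → ¬ InBox (cell x y ⊕ offset d) →
              outgoing d (cell x y) ∈ exitEdges
  exit-edge {x} {y} east out with last-or-below x
  ... | inj₁ refl     = via-east outgoing lastColumn lastRow (on-column x y)
  ... | inj₂ (x⁺ , e) = ⊥-elim (out (x⁺ , y , cell-⊕ 1 0 e (sym (ℕP.+-identityʳ (toℕ y)))))
  exit-edge {x} {y} north out with last-or-below y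
  ... | inj₁ refl     = via-north outgoing lastColumn lastRow (on-row x y)
  ... | inj₂ (y⁺ , e) = ⊥-elim (out (x , y⁺ , cell-⊕ 0 1 (sym (ℕP.+-identityʳ (toℕ x))) e))
  exit-edge {x} {y} ne out with last-or-below x | last-or-below y
  ... | inj₁ refl      | _              = via-ne outgoing lastColumn lastRow (∈-++⁺ˡ (on-column x y))
  ... | inj₂ _         | inj₁ refl      = via-ne outgoing lastColumn lastRow (∈-++⁺ʳ lastColumn (on-row x y))
  ... | inj₂ (x⁺ , ex) | inj₂ (y⁺ , ey) = ⊥-elim (out (x⁺ , y⁺ , cell-⊕ 1 1 ex ey))

  entry-edge : ∀ {u x y d} → Ascent d → cell x y ≡ u ⊕ offset d → ¬ InBox u →
               (u , cell x y) ∈ entryEdges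
  entry-edge {u} {x} {y} {d} asc e out =
    subst (λ t → (t , cell x y) ∈ entryEdges) tail≡u (member asc)
    where
    tail≡u : cell x y ⊕ offset (reverse d) ≡ u
    tail≡u = trans (cong (_⊕ offset (reverse d)) e) (⊕-undo u d)
    inside : ∀ x' y' → ¬ (cell x' y' ⊕ offset d ≡ cell x y)
    inside x' y' e' = out (x' , y' , sym (⊕-cancel-offset d (trans e' e)))
    member : Ascent d → incoming d (cell x y) ∈ entryEdges
    member east with first-or-above x
    ... | inj₁ refl     = via-east incoming firstColumn firstRow (on-column x y)
    ... | inj₂ (x⁻ , e) = ⊥-elim (inside x⁻ y (cell-⊕ 1 0 e (sym (ℕP.+-identityʳ (toℕ y)))))
    member north with first-or-above y
    ... | inj₁ refl     = via-north incoming firstColumn firstRow (on-row x y)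
    ... | inj₂ (y⁻ , e) = ⊥-elim (inside x y⁻ (cell-⊕ 0 1 (sym (ℕP.+-identityʳ (toℕ x))) e))
    member ne with first-or-above x | first-or-above y
    ... | inj₁ refl      | _              = via-ne incoming firstColumn firstRow (∈-++⁺ˡ (on-column x y))
    ... | inj₂ _         | inj₁ refl      = via-ne incoming firstColumn firstRow (∈-++⁺ʳ firstColumn (on-row x y))
    ... | inj₂ (x⁻ , ex) | inj₂ (y⁻ , ey) = ⊥-elim (inside x⁻ y⁻ (cell-⊕ 1 1 ex ey))

  leaves-box : ∀ {u v n} (w : Walk u v n) → AscendingWalk w → InBox u → ¬ InBox v →
               Traverses w exitEdges
  leaves-box w asc inᵤ outᵥ with walk-entry (λ v → ¬ InBox v) (λ v → ¬? (inBox? v)) w (λ out → out inᵤ) outᵥ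
  ... | p , p<n , ¬out , out with decidable-stable (inBox? _) ¬out | asc p p<n
  ...   | x , y , here | d , ascent , next =
    p , p<n , subst (_∈ exitEdges) (sym (cong₂ _,_ here next'))
                (exit-edge ascent (λ inside → out (subst InBox (sym next') inside)))
    where
    next' : vertexAt w (suc p) ≡ cell x y ⊕ offset d
    next' = trans next (cong (_⊕ offset d) here)

  enters-box : ∀ {u v n} (w : Walk u v n) → AscendingWalk w → ¬ InBox u → InBox v →
               Traverses w entryEdges
  enters-box w asc outᵤ inᵥ with walk-entry InBox inBox? w outᵤ inᵥ
  ... | p , p<n , out , (x , y , here) with asc p p<n
  ...   | d , ascent , next =
    p , p<n , subst (λ h → (vertexAt w p , h) ∈ entryEdges) (sym here)
                (entry-edge ascent (trans (sym here) next) out)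

module Congestion {I : Instance} {T : ℕ} (sc : ShortestPathSchedule I T) where
  open Instance I
  open ShortestPathSchedule sc

  record Passage (i : Fin P) (p : ℕ) : Set where
    field
      time       : ℕ
      before-end : time < T
      at         : prog i time ≡ p
      advances   : prog i (suc time) ≡ suc p

  passage : ∀ i p → p < len i → Passage i p
  passage i p p<len with first-entry (λ t → p < prog i t) (λ t → p ℕ.<? prog i t) T
                          (λ p<prog₀ → ℕP.n≮0 (subst (p <_) (start i) p<prog₀))
                          (subst (p <_) (sym (finish i)) p<len)
  ... | t , t<T , not-yet , passed with step i t
  ...   | inj₁ stays = ⊥-elim (not-yet (subst (p <_) stays passed))
  ...   | inj₂ moves = record { time = t ; before-end = t<T ; at = at ; advances = trans moves (cong suc at) }
    where
    at : prog i t ≡ p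
    at = ℕP.≤-antisym (ℕP.≮⇒≥ not-yet) (ℕP.≤-pred (subst (p <_) moves passed))

  -- If every route traverses one of the edges es, the edge capacity of one packet per
  -- step and direction forces P ≤ T · |es|: packets are injectively labelled by (time, edge).
  congestion : (es : List (Node × Node)) → (∀ i → Traverses (route i) es) → P ≤ T * length es
  congestion es trav = FinP.injective⇒≤ {f = label} label-injective
    where
    pos-of : Fin P → ℕ
    pos-of i = proj₁ (trav i)
    crossing : ∀ i → Passage i (pos-of i)
    crossing i = passage i (pos-of i) (proj₁ (proj₂ (trav i)))
    time-of : Fin P → ℕ
    time-of i = Passage.time (crossing i)
    edge∈ : ∀ i → (vertexAt (route i) (pos-of i) , vertexAt (route i) (suc (pos-of i))) ∈ es
    edge∈ i = proj₂ (proj₂ (trav i))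
    time-label : Fin P → Fin T
    time-label i = fromℕ< (Passage.before-end (crossing i))
    edge-label : Fin P → Fin (length es)
    edge-label i = index (edge∈ i)
    label : Fin P → Fin (T * length es)
    label i = Fin.combine (time-label i) (edge-label i)
    position-then : ∀ k → pos k (time-of k) ≡ vertexAt (route k) (pos-of k)
    position-then k = cong (vertexAt (route k)) (Passage.at (crossing k))
    position-next : ∀ k → pos k (suc (time-of k)) ≡ vertexAt (route k) (suc (pos-of k))
    position-next k = cong (vertexAt (route k)) (Passage.advances (crossing k))
    moves-then : ∀ k → Moves k (time-of k)
    moves-then k = trans (Passage.advances (crossing k)) (cong suc (sym (Passage.at (crossing k))))
    label-injective : ∀ {i j} → label i ≡ label j → i ≡ j
    label-injective {i} {j} same with i Fin.≟ j
    ... | yes i≡j = i≡j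
    ... | no  i≢j = ⊥-elim (capacity i j (time-of i) i≢j (moves-then i)
                      (subst (Moves j) (sym same-time) (moves-then j)) same-tail same-head)
      where
      same-time : time-of i ≡ time-of j
      same-time = FinP.fromℕ<-injective _ _ _ _
        (FinP.combine-injectiveˡ (time-label i) (edge-label i) (time-label j) (edge-label j) same)
      same-edge : (vertexAt (route i) (pos-of i) , vertexAt (route i) (suc (pos-of i))) ≡
                  (vertexAt (route j) (pos-of j) , vertexAt (route j) (suc (pos-of j)))
      same-edge = trans (lookup-index (edge∈ i))
                    (trans (cong (lookup es) (FinP.combine-injectiveʳ (time-label i) (edge-label i) (time-label j) (edge-label j) same))
                           (sym (lookup-index (edge∈ j))))
      same-tail : pos i (time-of i) ≡ pos j (time-of i)
      same-tail = trans (position-then i) (trans (cong proj₁ same-edge)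
                    (sym (trans (cong (pos j) same-time) (position-then j))))
      same-head : pos i (suc (time-of i)) ≡ pos j (suc (time-of i))
      same-head = trans (position-next i) (trans (cong proj₂ same-edge)
                    (sym (trans (cong (λ t → pos j (suc t)) same-time) (position-next j))))

lookup-injective : ∀ {A : Set} {xs : List A} → Unique xs → ∀ {i j} → lookup xs i ≡ lookup xs j → i ≡ j
lookup-injective {xs = _ ∷ _} (_    ∷ _) {Fin.zero}  {Fin.zero}  _ = refl
lookup-injective {xs = _ ∷ _} (x∉xs ∷ _) {Fin.zero}  {Fin.suc j} e = ⊥-elim (All.lookup x∉xs (∈-lookup j) e)
lookup-injective {xs = _ ∷ _} (x∉xs ∷ _) {Fin.suc i} {Fin.zero}  e = ⊥-elim (All.lookup x∉xs (∈-lookup i) (sym e))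
lookup-injective {xs = _ ∷ _} (_    ∷ u) {Fin.suc i} {Fin.suc j} e = cong Fin.suc (lookup-injective u e)

fibre-bound : ∀ {P K} (f : Fin P → Node) (label : Fin P → Fin K) →
  (∀ i j → f i ≡ f j → label i ≡ label j → i ≡ j) →
  ∀ v → length (filter (λ i → f i ≟ₙ v) (allFin P)) ≤ K
fibre-bound {P} f label separates v = FinP.injective⇒≤ {f = λ k → label (lookup fibre k)} injective
  where
  fibre : List (Fin P)
  fibre = filter (λ i → f i ≟ₙ v) (allFin P)
  on-fibre : ∀ k → f (lookup fibre k) ≡ v
  on-fibre k = All.lookup (all-filter (λ i → f i ≟ₙ v) (allFin P)) (∈-lookup k)
  injective : ∀ {k l} → label (lookup fibre k) ≡ label (lookup fibre l) → k ≡ l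
  injective {k} {l} e = lookup-injective (Unique.filter⁺ (λ i → f i ≟ₙ v) (Unique.allFin⁺ P))
    (separates _ _ (trans (on-fibre k) (sym (on-fibre l))) e)

block-quotient : ∀ a .{{_ : NonZero a}} r x → x < a → (r * a + x) / a ≡ r
block-quotient a r x x<a = begin
  (r * a + x) / a    ≡⟨ +-distrib-/-∣ˡ x (divides r refl) ⟩
  r * a / a + x / a  ≡⟨ cong₂ _+_ (m*n/n≡m r a) (m<n⇒m/n≡0 x<a) ⟩
  r + 0              ≡⟨ ℕP.+-identityʳ r ⟩
  r                  ∎
  where open ≡-Reasoning

block-remainder : ∀ a .{{_ : NonZero a}} r x → x < a → (r * a + x) % a ≡ x
block-remainder a r x x<a =
  trans (cong (_% a) (ℕP.+-comm (r * a) x)) (trans ([m+kn]%n≡m%n x r a) (m<n⇒m%n≡m x<a))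

block-unique : ∀ a .{{_ : NonZero a}} {r r' x x'} → x < a → x' < a →
               r * a + x ≡ r' * a + x' → r ≡ r' × x ≡ x'
block-unique a {r} {r'} {x} {x'} x<a x'<a e =
  trans (sym (block-quotient a r x x<a)) (trans (cong (_/ a) e) (block-quotient a r' x' x'<a)) ,
  trans (sym (block-remainder a r x x<a)) (trans (cong (_% a) e) (block-remainder a r' x' x'<a))

divmod-injective : ∀ d .{{_ : NonZero d}} {m n} → m % d ≡ n % d → m / d ≡ n / d → m ≡ n
divmod-injective d {m} {n} e₁ e₂ =
  trans (m≡m%n+[m/n]*n m d) (trans (cong₂ (λ p q → p + q * d) e₁ e₂) (sym (m≡m%n+[m/n]*n n d)))

remQuot-injective : ∀ {n} k {i j : Fin (n * k)} → remQuot {n} k i ≡ remQuot k j → i ≡ j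
remQuot-injective {n} k {i} {j} e =
  trans (sym (FinP.combine-remQuot {n} k i)) (trans (cong (uncurry combine) e) (FinP.combine-remQuot {n} k j))

-- A routing instance together with the congestion bound making it hard: every
-- shortest-path schedule of length T routes a·a·L packets through 4a edges.
HardInstance : (ℓ k lmax a L : ℕ) → Set
HardInstance ℓ k lmax a L = Σ Instance λ I → IsRouting ℓ k I × MaxDist lmax I ×
  (∀ T → ShortestPathSchedule I T → (a * a) * L ≤ T * (4 * a))

-- The plane is cut into blocks of side a = a'+1, and block (p,q)
-- consists of the nodes (p·a + x, q·a + y) with x, y < a.  Each offset (x,y) of the hub
-- block (C,C) carries L packets; the packet of rank j belongs to group j / s and is routed
-- between the hub node and the node with the same offset in block σ(group) written in
-- base b = S+1.  The assumptions say that σ is injective, that its digits stay below b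
-- (so the distance is at most S·a ≤ lmax) and that it never points at the hub block.
module Scatter (a' S L s' C lmax : ℕ) (σ : ℕ → ℕ)
  (σ-injective : ∀ {g h} → σ g ≡ σ h → g ≡ h)
  (σ-range : ∀ j → j < L → σ (j / suc s') < suc S * suc S)
  (σ-avoids-hub : ∀ j → j < L → σ (j / suc s') ≢ C + C * suc S)
  (reach : S * suc a' ≤ lmax) where

  a s b P : ℕ
  a = suc a'
  s = suc s'
  b = suc S
  P = (a * a) * L

  block : ℕ → ℕ → ℕ → ℕ → Node
  block p q x y = (+ (p * a + x) , + (q * a + y))

  block-injective : ∀ p q p' q' {x y x' y'} → x < a → y < a → x' < a → y' < a →
    block p q x y ≡ block p' q' x' y' → (p ≡ p' × x ≡ x') × (q ≡ q' × y ≡ y')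
  block-injective p q p' q' x<a y<a x'<a y'<a e =
    block-unique a x<a x'<a (ℤP.+-injective (cong proj₁ e)) ,
    block-unique a y<a y'<a (ℤP.+-injective (cong proj₂ e))

  -- Packet i sits at the offset (X i , Y i) of its block and has rank i among
  -- the L packets sharing that offset; ranks are grouped into groups of s.
  offset-index : Fin P → Fin (a * a)
  offset-index i = proj₁ (remQuot {a * a} L i)

  rank : Fin P → Fin L
  rank i = proj₂ (remQuot {a * a} L i)

  X Y : Fin P → Fin a
  X i = proj₁ (remQuot {a} a (offset-index i))
  Y i = proj₂ (remQuot {a} a (offset-index i))

  x y : Fin P → ℕ
  x i = toℕ (X i)
  y i = toℕ (Y i)

  group slot r₁ r₂ : Fin P → ℕ
  group i = toℕ (rank i) / s
  slot i = σ (group i)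
  r₁ i = slot i % b
  r₂ i = slot i / b

  member : Fin P → Fin s
  member i = fromℕ< (m%n<n (toℕ (rank i)) s)

  hub spoke : Fin P → Node
  hub i = block C C (x i) (y i)
  spoke i = block (r₁ i) (r₂ i) (x i) (y i)

  packet-injective : ∀ {i i'} → X i ≡ X i' → Y i ≡ Y i' → rank i ≡ rank i' → i ≡ i'
  packet-injective {i} {i'} eX eY eR =
    remQuot-injective {a * a} L (cong₂ _,_ (remQuot-injective {a} a (cong₂ _,_ eX eY)) eR)

  x<a : ∀ i → x i < a
  x<a i = FinP.toℕ<n (X i)

  y<a : ∀ i → y i < a
  y<a i = FinP.toℕ<n (Y i)

  hub-fibre : ∀ v → length (filter (λ i → hub i ≟ₙ v) (allFin P)) ≤ L
  hub-fibre = fibre-bound hub rank separates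
    where
    separates : ∀ i i' → hub i ≡ hub i' → rank i ≡ rank i' → i ≡ i'
    separates i i' e eR with block-injective C C C C (x<a i) (y<a i) (x<a i') (y<a i') e
    ... | (_ , ex) , (_ , ey) = packet-injective (FinP.toℕ-injective ex) (FinP.toℕ-injective ey) eR

  slot-injective : ∀ {i i'} → r₁ i ≡ r₁ i' → r₂ i ≡ r₂ i' → group i ≡ group i'
  slot-injective e₁ e₂ = σ-injective (divmod-injective b e₁ e₂)

  spoke-fibre : ∀ v → length (filter (λ i → spoke i ≟ₙ v) (allFin P)) ≤ s
  spoke-fibre = fibre-bound spoke member separates
    where
    separates : ∀ i i' → spoke i ≡ spoke i' → member i ≡ member i' → i ≡ i'
    separates i i' e eM with block-injective (r₁ i) (r₂ i) (r₁ i') (r₂ i') (x<a i) (y<a i) (x<a i') (y<a i') e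
    ... | (e₁ , ex) , (e₂ , ey) = packet-injective (FinP.toℕ-injective ex) (FinP.toℕ-injective ey)
          (FinP.toℕ-injective (divmod-injective s same-member (slot-injective e₁ e₂)))
      where
      same-member : toℕ (rank i) % s ≡ toℕ (rank i') % s
      same-member = trans (sym (FinP.toℕ-fromℕ< _)) (trans (cong toℕ eM) (FinP.toℕ-fromℕ< _))

  slot< : ∀ i → slot i < b * b
  slot< i = σ-range (toℕ (rank i)) (FinP.toℕ<n (rank i))

  r₁≤S : ∀ i → r₁ i ≤ S
  r₁≤S i = ℕP.≤-pred (m%n<n (slot i) b)

  r₂≤S : ∀ i → r₂ i ≤ S
  r₂≤S i = ℕP.≤-pred (m<n*o⇒m/o<n (slot< i))

  module HubBox = Box (C * a) a'

  hub-inside : ∀ i → HubBox.InBox (hub i)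
  hub-inside i = X i , Y i , refl

  spoke-outside : ∀ i → ¬ HubBox.InBox (spoke i)
  spoke-outside i (x' , y' , e)
    with block-injective (r₁ i) (r₂ i) C C (x<a i) (y<a i) (FinP.toℕ<n x') (FinP.toℕ<n y') e
  ... | (e₁ , _) , (e₂ , _) = σ-avoids-hub (toℕ (rank i)) (FinP.toℕ<n (rank i))
          (trans (m≡m%n+[m/n]*n (slot i) b) (cong₂ (λ p q → p + q * b) e₁ e₂))

  shift-blocks : ∀ {p p'} z → p ≤ p' → p' * a + z ≡ (p * a + z) + (p' ∸ p) * a
  shift-blocks {p} {p'} z p≤p' =
    trans (cong (λ t → t * a + z) (sym (ℕP.m+[n∸m]≡n p≤p'))) (regroup p (p' ∸ p) a z)
    where
    regroup : ∀ p d a z → (p + d) * a + z ≡ (p * a + z) + d * a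
    regroup = solve-∀

  displacement : ∀ {p q p' q'} z w → p ≤ p' → q ≤ q' →
    block p' q' z w ≡ block p q z w ⊕ (+ ((p' ∸ p) * a) , + ((q' ∸ q) * a))
  displacement z w p≤p' q≤q' = cong₂ (λ m n → (+ m , + n)) (shift-blocks z p≤p') (shift-blocks w q≤q')

  within-reach : ∀ {p p'} → p' ≤ S → (p' ∸ p) * a ≤ lmax
  within-reach {p} {p'} p'≤S = ℕP.≤-trans (ℕP.*-monoˡ-≤ a (ℕP.≤-trans (ℕP.m∸n≤m p' p) p'≤S)) reach

  block-distance : ∀ {p q p' q'} z w → p ≤ p' → q ≤ q' → p' ≤ S → q' ≤ S →
    DistLe (block p q z w) (block p' q' z w) lmax
  block-distance {p} {q} {p'} {q'} z w p≤p' q≤q' p'≤S q'≤S =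
    dx ⊔ dy , ℕP.⊔-lub (within-reach {p} p'≤S) (within-reach {q} q'≤S) ,
    subst (λ t → Walk (block p q z w) t (dx ⊔ dy)) (sym (displacement z w p≤p' q≤q'))
          (diagonalWalk (block p q z w) dx dy)
    where
    dx dy : ℕ
    dx = (p' ∸ p) * a
    dy = (q' ∸ q) * a

  -- Packets leave the hub for their spokes: at most L per origin, s per destination,
  -- and each must use one of the 4a exit edges of the hub block.
  outward : C ≡ 0 → HardInstance L s lmax a L
  outward refl = I , (λ v → hub-fibre v , spoke-fibre v) , distance , bound
    where
    I : Instance
    I = record { P = P ; origin = hub ; dest = spoke }
    distance : MaxDist lmax I
    distance i = block-distance {p' = r₁ i} {q' = r₂ i} (x i) (y i) z≤n z≤n (r₁≤S i) (r₂≤S i)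
    bound : ∀ T → ShortestPathSchedule I T → P ≤ T * (4 * a)
    bound T sc = subst (λ n → P ≤ T * n) (HubBox.boundary-length outgoing _ _)
                   (Congestion.congestion sc HubBox.exitEdges exits)
      where
      open ShortestPathSchedule sc
      exits : ∀ i → Traverses (route i) HubBox.exitEdges
      exits i = HubBox.leaves-box (route i)
        (shortest-ascending (route i) (shortest i) _ _ (displacement {p' = r₁ i} {q' = r₂ i} (x i) (y i) z≤n z≤n))
        (hub-inside i) (spoke-outside i)

  -- Packets travel from their spokes into the hub: at most s per origin, L per
  -- destination, and each must use one of the 4a entry edges of the hub block.
  inward : C ≡ S → HardInstance s L lmax a L
  inward refl = I , (λ v → spoke-fibre v , hub-fibre v) , distance , bound
    where
    I : Instance
    I = record { P = P ; origin = spoke ; dest = hub }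
    distance : MaxDist lmax I
    distance i = block-distance (x i) (y i) (r₁≤S i) (r₂≤S i) ℕP.≤-refl ℕP.≤-refl
    bound : ∀ T → ShortestPathSchedule I T → P ≤ T * (4 * a)
    bound T sc = subst (λ n → P ≤ T * n) (HubBox.boundary-length incoming _ _)
                   (Congestion.congestion sc HubBox.entryEdges entries)
      where
      open ShortestPathSchedule sc
      entries : ∀ i → Traverses (route i) HubBox.entryEdges
      entries i = HubBox.enters-box (route i)
        (shortest-ascending (route i) (shortest i) _ _ (displacement (x i) (y i) (r₁≤S i) (r₂≤S i)))
        (spoke-outside i) (hub-inside i)

integer-sqrt : ∀ c → Σ ℕ λ S → S * S ≤ c × c < suc S * suc S
integer-sqrt zero = 0 , z≤n , s≤s z≤n
integer-sqrt (suc c) with integer-sqrt c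
... | S , S²≤c , c<[S+1]² with suc S * suc S ℕ.≤? suc c
...   | yes [S+1]²≤c+1 = suc S , [S+1]²≤c+1 ,
          ℕP.≤-<-trans c<[S+1]² (ℕP.*-mono-< (ℕP.n<1+n (suc S)) (ℕP.n<1+n (suc S)))
...   | no  [S+1]²≰c+1 = S , ℕP.m≤n⇒m≤1+n S²≤c , ℕP.≰⇒> [S+1]²≰c+1

ceilDiv-covers : ∀ L s' → L ≤ ceilDiv L (suc s') * suc s'
ceilDiv-covers L s' = ℕP.+-cancelʳ-≤ s' L _ (begin
  L + s'                          ≡⟨ m≡m%n+[m/n]*n (L + s') (suc s') ⟩
  (L + s') % suc s' + q * suc s'  ≤⟨ ℕP.+-monoˡ-≤ (q * suc s') (ℕP.≤-pred (m%n<n (L + s') (suc s'))) ⟩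
  s' + q * suc s'                 ≡⟨ ℕP.+-comm s' (q * suc s') ⟩
  q * suc s' + s'                 ∎)
  where
  open ℕP.≤-Reasoning
  q : ℕ
  q = (L + s') / suc s'

ceilDiv4-≤ : ∀ n T → n ≤ 4 * T → ceilDiv n 4 ≤ T
ceilDiv4-≤ n T n≤4T = ℕP.≤-pred (m<n*o⇒m/o<n (ℕP.≤-<-trans (ℕP.+-monoˡ-≤ 3 n≤4T) (ℕP.≤-reflexive (unfold T))))
  where
  unfold : ∀ T → suc (4 * T + 3) ≡ suc T * 4
  unfold = solve-∀

squares-reflect-< : ∀ {x y} → x * x < y * y → x < y
squares-reflect-< {x} {y} x²<y² = ℕP.≰⇒> (λ y≤x → ℕP.<⇒≱ x²<y² (ℕP.*-mono-≤ y≤x y≤x))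

blocks-fit : ∀ S c lmax m → S * S ≤ c →
  m * m * (c + 1) ≤ (lmax + 1) * (lmax + 1) → m * S ≤ lmax
blocks-fit S c lmax zero    _    _    = z≤n
blocks-fit S c lmax m@(suc _) S²≤c room =
  ℕP.m<1+n⇒m≤n (subst (m * S <_) (ℕP.+-comm lmax 1) (squares-reflect-< (begin-strict
    (m * S) * (m * S)        ≡⟨ regroup m S ⟩
    (m * m) * (S * S)        ≤⟨ ℕP.*-monoʳ-≤ (m * m) S²≤c ⟩
    (m * m) * c              <⟨ ℕP.*-monoʳ-< (m * m) (ℕP.m<m+n c (s≤s z≤n)) ⟩
    (m * m) * (c + 1)        ≤⟨ room ⟩
    (lmax + 1) * (lmax + 1)  ∎)))
  where
  open ℕP.≤-Reasoning
  regroup : ∀ m S → (m * S) * (m * S) ≡ (m * m) * (S * S)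
  regroup = solve-∀

spacing-bound : ∀ S' c lmax m → suc S' * suc S' ≤ c →
  m * m * (c + 1) ≤ (lmax + 1) * (lmax + 1) → m ≤ lmax / suc S'
spacing-bound S' c lmax m S²≤c room =
  subst (_≤ lmax / suc S') (m*n/n≡m m (suc S')) (/-monoˡ-≤ (suc S') (blocks-fit (suc S') c lmax m S²≤c room))

rate-bound : ∀ L T m a → m ≤ a → (a * a) * L ≤ T * (4 * a) → ceilDiv (L * m) 4 ≤ T
rate-bound L T .zero zero    z≤n _ = ceilDiv4-≤ (L * 0) T (subst (_≤ 4 * T) (sym (ℕP.*-zeroʳ L)) z≤n)
rate-bound L T m     (suc a') m≤a congested =
  ceilDiv4-≤ (L * m) T (ℕP.≤-trans (ℕP.*-monoʳ-≤ L m≤a) La≤4T)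
  where
  a : ℕ
  a = suc a'
  La≤4T : L * a ≤ 4 * T
  La≤4T = ℕP.*-cancelˡ-≤ a (subst₂ _≤_ (lhs a L) (rhs a T) congested)
    where
    lhs : ∀ a L → (a * a) * L ≡ a * (L * a)
    lhs = solve-∀
    rhs : ∀ a T → T * (4 * a) ≡ a * (4 * T)
    rhs = solve-∀

routing-mono : ∀ {ℓ k ℓ' k' I} → ℓ ≤ ℓ' → k ≤ k' → IsRouting ℓ k I → IsRouting ℓ' k' I
routing-mono ℓ≤ℓ' k≤k' routing v =
  ℕP.≤-trans (proj₁ (routing v)) ℓ≤ℓ' , ℕP.≤-trans (proj₂ (routing v)) k≤k'

hard-mono : ∀ {ℓ k ℓ' k' lmax a L} → ℓ ≤ ℓ' → k ≤ k' → HardInstance ℓ k lmax a L → HardInstance ℓ' k' lmax a L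
hard-mono ℓ≤ℓ' k≤k' (I , routing , distance , bound) = I , routing-mono {I = I} ℓ≤ℓ' k≤k' routing , distance , bound

no-packets : ∀ {ℓ k lmax L} → HardInstance ℓ k lmax 0 L
no-packets = record { P = 0 ; origin = λ () ; dest = λ () } , (λ _ → z≤n , z≤n) , (λ ()) , (λ _ _ → z≤n)

hard-consequence : ∀ {ℓ k lmax a L c} → HardInstance ℓ k lmax a L →
  (∀ m → m * m * (c + 1) ≤ (lmax + 1) * (lmax + 1) → m ≤ a) →
  Σ Instance λ I → IsRouting ℓ k I × MaxDist lmax I ×
    (∀ T → ShortestPathSchedule I T →
      ∀ m → m * m * (c + 1) ≤ (lmax + 1) * (lmax + 1) → ceilDiv (L * m) 4 ≤ T)
hard-consequence {a = a} {L} (I , routing , distance , bound) m≤a =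
  I , routing , distance , λ T sc m room → rate-bound L T m a (m≤a m room) (bound T sc)

-- The instance for ℓ = l'+1 and k = k'+1: with L = max(ℓ,k), s = min(ℓ,k) and
-- c = ⌈L/s⌉ < (S+1)², blocks of any side a with S·a ≤ lmax give a hard instance;
-- the hub is (0,0) with σ g = g+1 if k ≤ ℓ, and (S,S) with σ g = g otherwise.
module Construction (l' k' lmax : ℕ) where

  L s' c : ℕ
  L = suc l' ⊔ suc k'
  s' = l' ⊓ k'
  c = ceilDiv L (suc s')

  group< : ∀ j → j < L → j / suc s' < c
  group< j j<L = m<n*o⇒m/o<n (ℕP.<-≤-trans j<L (ceilDiv-covers L s'))

  c-positive : 1 ≤ c
  c-positive = ℕP.n≢0⇒n>0 (λ c≡0 → no-room (subst (λ z → L ≤ z * suc s') c≡0 (ceilDiv-covers L s')))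
    where
    no-room : ¬ (L ≤ 0)
    no-room ()

  hard : ∀ S → c < suc S * suc S → ∀ a → S * a ≤ lmax → HardInstance (suc l') (suc k') lmax a L
  hard S c<b² zero    _     = no-packets {L = L}
  hard S c<b² (suc a') reach with ℕP.≤-total (suc k') (suc l')
  ... | inj₁ k≤ℓ = hard-mono (ℕP.≤-reflexive (ℕP.m≥n⇒m⊔n≡m k≤ℓ)) (ℕP.m⊓n≤n (suc l') (suc k'))
        (Scatter.outward a' S L s' 0 lmax suc ℕP.suc-injective
          (λ j j<L → ℕP.≤-<-trans (group< j j<L) c<b²) (λ _ _ ()) reach refl)
  ... | inj₂ ℓ≤k = hard-mono (ℕP.m⊓n≤m (suc l') (suc k')) (ℕP.≤-reflexive (ℕP.m≤n⇒m⊔n≡n ℓ≤k))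
        (Scatter.inward a' S L s' S lmax id id
          (λ j j<L → ℕP.<-trans (group< j j<L) c<b²)
          (λ j j<L → ℕP.<⇒≢ (ℕP.<-≤-trans (group< j j<L) (ℕP.≤-pred c<b²))) reach refl)

-- The theorem: S = ⌊√c⌋ is positive because c ≥ 1; blocks of side ⌊lmax/S⌋ give a
-- hard instance, and every admissible m is at most that side.
mainTheorem9 : (ℓ k lmax : ℕ) → 1 ≤ ℓ → 1 ≤ k → 1 ≤ lmax →
    Σ Instance λ I → IsRouting ℓ k I × MaxDist lmax I ×
      (∀ T → ShortestPathSchedule I T →
        ∀ m → m * m * (ceilDiv (ℓ ⊔ k) (ℓ ⊓ k) + 1) ≤ (lmax + 1) * (lmax + 1) →
          ceilDiv ((ℓ ⊔ k) * m) 4 ≤ T)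
mainTheorem9 (suc l') (suc k') lmax _ _ _ with integer-sqrt (Construction.c l' k' lmax)
... | zero , _ , c<1 = ⊥-elim (ℕP.<-irrefl refl (ℕP.<-≤-trans c<1 (Construction.c-positive l' k' lmax)))
... | suc S' , S²≤c , c<b² = hard-consequence
        (Construction.hard l' k' lmax (suc S') c<b² (lmax / suc S')
          (subst (_≤ lmax) (ℕP.*-comm (lmax / suc S') (suc S')) (m/n*n≤m lmax (suc S'))))
        (λ m → spacing-bound S' _ lmax m S²≤c)
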